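{- For every $k\geq 3$, there is no partition $P$ of $V(C_k)$ such that $C_k/P\cong C_{k-1}$.
   Context: $C_k$ is the cycle of length $k$. For a graph $H$ and a partition $P=\{U_1,\dots,U_m\}$ of $V(H)$, the quotient graph $H/P$ has vertex set $P$, with $U_i,U_j$ adjacent (a loop if $i=j$) iff there are $u_i\in U_i,u_j\in U_j$ with $\{u_i,u_j\}\in E(H)$. -}

module Defs where

open import Data.Nat using (ℕ; suc)
open import Data.Fin using (Fin; toℕ)
open import Data.Product using (_×_; ∃; Σ)
open import Data.Sum using (_⊎_)
open import Relation.Binary.PropositionalEquality using (_≡_)
open import Function.Bundles using (Bijection)
open import Level using (0ℓ)
open import Relation.Binary.PropositionalEquality using (setoid)

-- A (finite) graph on vertex set Fin n, given by its adjacency relation.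
-- Loops (Adj v v) are allowed, since quotient graphs may have loops.
record Graph : Set₁ where
  field
    size : ℕ
    Adj  : Fin size → Fin size → Set

open Graph public

-- Adjacency of the cycle C_k on vertices 0,…,k-1: i ~ j iff j = i+1 mod k
-- (symmetrised).  For k ≥ 3 this is exactly the simple cycle C_k.
CycleAdj : (k : ℕ) → Fin k → Fin k → Set
CycleAdj k i j =
    (toℕ j ≡ suc (toℕ i))
  ⊎ (toℕ i ≡ suc (toℕ j))
  ⊎ (suc (toℕ i) ≡ k × toℕ j ≡ 0)
  ⊎ (suc (toℕ j) ≡ k × toℕ i ≡ 0)

Cycle : ℕ → Graph
Cycle k = record { size = k ; Adj = CycleAdj k }

-- A partition P = {U_1,…,U_m} of V(H) = Fin n is represented by a labelling
-- f : Fin n → Fin m (U_b = f⁻¹(b)); surjectivity makes every block nonempty.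
record Partition (n : ℕ) : Set where
  field
    blocks : ℕ
    block  : Fin n → Fin blocks
    onto   : ∀ (b : Fin blocks) → ∃ λ (u : Fin n) → block u ≡ b

open Partition public

Quotient : (H : Graph) → Partition (size H) → Graph
Quotient H P = record
  { size = blocks P
  ; Adj  = λ a b → ∃ λ u → ∃ λ v → block P u ≡ a × block P v ≡ b × Adj H u v }

record _≅_ (G H : Graph) : Set where
  field
    bij      : Bijection (setoid (Fin (size G))) (setoid (Fin (size H)))
    preserve : ∀ a b → Adj G a b → Adj H (Bijection.to bij a) (Bijection.to bij b)
    reflect  : ∀ a b → Adj H (Bijection.to bij a) (Bijection.to bij b) → Adj G a b

module Submission where

-- A partition P with C_k/P ≅ C_{k-1} gives a surjection g : V(C_k) → V(C_{k-1}) preserving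
-- adjacency, such that every edge of C_{k-1} has adjacent preimages.  By counting, g merges
-- exactly one pair u ≠ v and is injective elsewhere.  Since C_{k-1} has no loops, u and v are
-- not adjacent, so their neighbours lie outside {u, v} and are mapped injectively to the
-- neighbours of g u, of which there are only two.  Hence the neighbours of u are those of v,
-- so k = 4; but then the edge of the triangle C_3 joining the images of the two neighbours
-- of u has no adjacent preimage.

open import Defs
open import Data.Nat using (ℕ; _≤_; _∸_)
open import Relation.Nullary using (¬_)
open import Data.Product using (Σ)

open import Data.Nat.Base using (zero; suc; _+_; _*_; _<_; NonZero; z≤n; s≤s; z<s; s<s)
open import Data.Nat.Properties using (_<?_; n<1+n; ≤-antisym; ≮⇒≥; <⇒≢; 1+n≰n; +-identityʳ; +-suc; +-assoc; +-cancelˡ-≡; *-distribʳ-+; suc-injective)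
open import Data.Nat.Divisibility using (_∣_; divides; >⇒∤)
open import Data.Fin.Base using (Fin; zero; suc; toℕ; fromℕ; fromℕ<; inject₁; punchIn; punchOut)
open import Data.Fin.Properties using (_≟_; toℕ<n; toℕ-fromℕ<; toℕ-fromℕ; toℕ-inject₁; toℕ-injective; punchOut-injective; punchIn-punchOut; pigeonhole; injective⇒≤)
open import Data.Product using (_×_; _,_; ∃; ∃₂; proj₁; proj₂)
open import Data.Sum using (_⊎_; inj₁; inj₂)
open import Data.Empty using (⊥)
open import Function.Base using (_∘_)
open import Function.Definitions using (Injective; StrictlySurjective)
open import Function.Bundles using (Bijection)
open import Relation.Nullary using (yes; no; contradiction)
open import Relation.Binary.PropositionalEquality

private variable
  m n : ℕ

IsNext : Fin m → Fin m → Set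
IsNext {m} i j = toℕ j ≡ suc (toℕ i) ⊎ (suc (toℕ i) ≡ m × toℕ j ≡ 0)

IsNext-functional : {i j j′ : Fin m} → IsNext i j → IsNext i j′ → j ≡ j′
IsNext-functional (inj₁ j≡1+i) (inj₁ j′≡1+i) = toℕ-injective (trans j≡1+i (sym j′≡1+i))
IsNext-functional {j = j} (inj₁ j≡1+i) (inj₂ (1+i≡m , _)) =
  contradiction (trans j≡1+i 1+i≡m) (<⇒≢ (toℕ<n j))
IsNext-functional {j′ = j′} (inj₂ (1+i≡m , _)) (inj₁ j′≡1+i) =
  contradiction (trans j′≡1+i 1+i≡m) (<⇒≢ (toℕ<n j′))
IsNext-functional (inj₂ (_ , j≡0)) (inj₂ (_ , j′≡0)) = toℕ-injective (trans j≡0 (sym j′≡0))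

IsNext-injective : {i i′ j : Fin m} → IsNext i j → IsNext i′ j → i ≡ i′
IsNext-injective (inj₁ j≡1+i) (inj₁ j≡1+i′) =
  toℕ-injective (suc-injective (trans (sym j≡1+i) j≡1+i′))
IsNext-injective (inj₁ j≡1+i) (inj₂ (_ , j≡0)) with () ← trans (sym j≡1+i) j≡0
IsNext-injective (inj₂ (_ , j≡0)) (inj₁ j≡1+i′) with () ← trans (sym j≡1+i′) j≡0
IsNext-injective (inj₂ (1+i≡m , _)) (inj₂ (1+i′≡m , _)) =
  toℕ-injective (suc-injective (trans 1+i≡m (sym 1+i′≡m)))

next : Fin m → Fin m
next {suc m} i with suc (toℕ i) <? suc m
... | yes 1+i<m = fromℕ< 1+i<m
... | no  _     = zero

prev : Fin m → Fin m
prev {suc m} zero    = fromℕ m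
prev {suc m} (suc i) = inject₁ i

next-isNext : (i : Fin m) → IsNext i (next i)
next-isNext {suc m} i with suc (toℕ i) <? suc m
... | yes 1+i<m = inj₁ (toℕ-fromℕ< 1+i<m)
... | no  1+i≮m = inj₂ (≤-antisym (toℕ<n i) (≮⇒≥ 1+i≮m) , refl)

prev-isNext : (i : Fin m) → IsNext (prev i) i
prev-isNext {suc m} zero    = inj₂ (cong suc (toℕ-fromℕ m) , refl)
prev-isNext {suc m} (suc i) = inj₁ (cong suc (sym (toℕ-inject₁ i)))

next-prev : (i : Fin m) → next (prev i) ≡ i
next-prev i = IsNext-functional (next-isNext (prev i)) (prev-isNext i)

next-injective : {i j : Fin m} → next i ≡ next j → i ≡ j
next-injective {i = i} {j} eq =
  IsNext-injective (next-isNext i) (subst (IsNext j) (sym eq) (next-isNext j))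

prev-next : (i : Fin m) → prev (next i) ≡ i
prev-next i = next-injective (next-prev (next i))

prev-injective : {i j : Fin m} → prev i ≡ prev j → i ≡ j
prev-injective {i = i} {j} eq = trans (sym (next-prev i)) (trans (cong next eq) (next-prev j))

isNext⇒adjacent : {i j : Fin m} → IsNext i j → CycleAdj m i j
isNext⇒adjacent (inj₁ e) = inj₁ e
isNext⇒adjacent (inj₂ e) = inj₂ (inj₂ (inj₁ e))

isNext⇒adjacent˘ : {i j : Fin m} → IsNext j i → CycleAdj m i j
isNext⇒adjacent˘ (inj₁ e) = inj₂ (inj₁ e)
isNext⇒adjacent˘ (inj₂ e) = inj₂ (inj₂ (inj₂ e))

adjacent⇒isNext : {i j : Fin m} → CycleAdj m i j → IsNext i j ⊎ IsNext j i
adjacent⇒isNext (inj₁ e)                 = inj₁ (inj₁ e)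
adjacent⇒isNext (inj₂ (inj₁ e))          = inj₂ (inj₁ e)
adjacent⇒isNext (inj₂ (inj₂ (inj₁ e)))   = inj₁ (inj₂ e)
adjacent⇒isNext (inj₂ (inj₂ (inj₂ e)))   = inj₂ (inj₂ e)

next-adjacent : (i : Fin m) → CycleAdj m i (next i)
next-adjacent i = isNext⇒adjacent (next-isNext i)

prev-adjacent : (i : Fin m) → CycleAdj m i (prev i)
prev-adjacent i = isNext⇒adjacent˘ (prev-isNext i)

adjacent⇒next⊎prev : {i j : Fin m} → CycleAdj m i j → j ≡ next i ⊎ j ≡ prev i
adjacent⇒next⊎prev {i = i} {j} adj with adjacent⇒isNext adj
... | inj₁ i→j = inj₁ (IsNext-functional i→j (next-isNext i))
... | inj₂ j→i = inj₂ (IsNext-injective j→i (prev-isNext i))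

next^ : ℕ → Fin m → Fin m
next^ zero    i = i
next^ (suc n) i = next (next^ n i)

isNext-wraps : {i j : Fin m} → IsNext i j → ∃ λ w → toℕ j + w * m ≡ suc (toℕ i)
isNext-wraps (inj₁ j≡1+i)         = 0 , trans (+-identityʳ _) j≡1+i
isNext-wraps (inj₂ (1+i≡m , j≡0)) = 1 , trans (cong₂ _+_ j≡0 (+-identityʳ _)) (sym 1+i≡m)

next^-wraps : ∀ n (i : Fin m) → ∃ λ w → toℕ (next^ n i) + w * m ≡ toℕ i + n
next^-wraps zero    i = 0 , refl
next^-wraps {m} (suc n) i
  with w , wraps ← next^-wraps n i | w₁ , wraps₁ ← isNext-wraps (next-isNext (next^ n i)) =
  w₁ + w , (begin
    toℕ (next x) + (w₁ + w) * m       ≡⟨ cong (toℕ (next x) +_) (*-distribʳ-+ m w₁ w) ⟩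
    toℕ (next x) + (w₁ * m + w * m)   ≡⟨ sym (+-assoc (toℕ (next x)) _ _) ⟩
    toℕ (next x) + w₁ * m + w * m     ≡⟨ cong (_+ w * m) wraps₁ ⟩
    suc (toℕ x + w * m)               ≡⟨ cong suc wraps ⟩
    suc (toℕ i + n)                   ≡⟨ sym (+-suc (toℕ i) n) ⟩
    toℕ i + suc n                     ∎)
  where
  open ≡-Reasoning
  x : Fin m
  x = next^ n i

next^-fixed⇒∣ : {i : Fin m} → next^ n i ≡ i → m ∣ n
next^-fixed⇒∣ {m} {n} {i} fixed with w , wraps ← next^-wraps n i =
  divides w (sym (+-cancelˡ-≡ (toℕ i) _ _ (trans (cong (λ j → toℕ j + w * m) (sym fixed)) wraps)))

next^-irrefl : .{{_ : NonZero n}} → n < m → (i : Fin m) → next^ n i ≢ i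
next^-irrefl n<m i = >⇒∤ n<m ∘ next^-fixed⇒∣

CycleAdj-irrefl : 1 < m → (i : Fin m) → ¬ CycleAdj m i i
CycleAdj-irrefl 1<m i adj with adjacent⇒next⊎prev adj
... | inj₁ i≡next = next^-irrefl 1<m i (sym i≡next)
... | inj₂ i≡prev = next^-irrefl 1<m i (trans (cong next i≡prev) (next-prev i))

next≢prev : 2 < m → (i : Fin m) → next i ≢ prev i
next≢prev 2<m i next≡prev = next^-irrefl 2<m i (trans (cong next next≡prev) (next-prev i))

adjacent-outside : 1 < m → {a b x : Fin m} → ¬ CycleAdj m a b → CycleAdj m a x → x ≢ a × x ≢ b
adjacent-outside 1<m {a} a≁b a~x = (λ { refl → CycleAdj-irrefl 1<m a a~x }) , (λ { refl → a≁b a~x })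

∣4⇒≡4 : 3 ≤ m → m ∣ 4 → m ≡ 4
∣4⇒≡4 {0} ()
∣4⇒≡4 {1} (s≤s ())
∣4⇒≡4 {2} (s≤s (s≤s ()))
∣4⇒≡4 {3} _ (divides (suc (suc _)) ())
∣4⇒≡4 {4} _ _ = refl
∣4⇒≡4 {suc (suc (suc (suc (suc _))))} _ m∣4 = contradiction m∣4 (>⇒∤ (s<s (s<s (s<s (s<s z<s)))))

triangle-complete : m ≡ 3 → {i j : Fin m} → i ≢ j → CycleAdj m i j
triangle-complete refl {zero}             {zero}             i≢j = contradiction refl i≢j
triangle-complete refl {zero}             {suc zero}         _   = inj₁ refl
triangle-complete refl {zero}             {suc (suc zero)}   _   = inj₂ (inj₂ (inj₂ (refl , refl)))
triangle-complete refl {suc zero}         {zero}             _   = inj₂ (inj₁ refl)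
triangle-complete refl {suc zero}         {suc zero}         i≢j = contradiction refl i≢j
triangle-complete refl {suc zero}         {suc (suc zero)}   _   = inj₁ refl
triangle-complete refl {suc (suc zero)}   {zero}             _   = inj₂ (inj₂ (inj₁ (refl , refl)))
triangle-complete refl {suc (suc zero)}   {suc zero}         _   = inj₂ (inj₁ refl)
triangle-complete refl {suc (suc zero)}   {suc (suc zero)}   i≢j = contradiction refl i≢j

among-two : ∀ {A : Set} {x y a b c : A} → a ≡ x ⊎ a ≡ y → b ≡ x ⊎ b ≡ y → c ≡ x ⊎ c ≡ y →
            a ≡ b ⊎ a ≡ c ⊎ b ≡ c
among-two (inj₁ a≡x) (inj₁ b≡x) _          = inj₁ (trans a≡x (sym b≡x))
among-two (inj₂ a≡y) (inj₂ b≡y) _          = inj₁ (trans a≡y (sym b≡y))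
among-two (inj₁ a≡x) (inj₂ _)   (inj₁ c≡x) = inj₂ (inj₁ (trans a≡x (sym c≡x)))
among-two (inj₂ a≡y) (inj₁ _)   (inj₂ c≡y) = inj₂ (inj₁ (trans a≡y (sym c≡y)))
among-two (inj₁ _)   (inj₂ b≡y) (inj₂ c≡y) = inj₂ (inj₂ (trans b≡y (sym c≡y)))
among-two (inj₂ _)   (inj₁ b≡x) (inj₁ c≡x) = inj₂ (inj₂ (trans b≡x (sym c≡x)))

injective-misses-nothing : {r : Fin m → Fin m} → Injective _≡_ _≡_ r → (z : Fin m) → ¬ (∀ y → r y ≢ z)
injective-misses-nothing {suc m} {r} r-injective z missed = 1+n≰n (injective⇒≤ punchOut-r-injective)
  where
  punchOut-r-injective : Injective _≡_ _≡_ (λ y → punchOut {i = z} (missed y ∘ sym))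
  punchOut-r-injective {y} {y′} = r-injective ∘ punchOut-injective (missed y ∘ sym) (missed y′ ∘ sym)

surjective⇒injective : {h : Fin m → Fin m} → StrictlySurjective _≡_ h → Injective _≡_ _≡_ h
surjective⇒injective {m} {h} surj {p} {q} hp≡hq with p ≟ q
... | yes p≡q = p≡q
... | no  p≢q = contradiction (proj₂ missing) (injective-misses-nothing r-injective _)
  where
  r : Fin m → Fin m
  r = proj₁ ∘ surj
  h∘r : ∀ y → h (r y) ≡ y
  h∘r = proj₂ ∘ surj
  r-injective : Injective _≡_ _≡_ r
  r-injective {y} {y′} eq = trans (sym (h∘r y)) (trans (cong h eq) (h∘r y′))
  missing : ∃ λ z → ∀ y → r y ≢ z
  missing with r (h p) ≟ p
  ... | no  rhp≢p = p , λ { y refl → rhp≢p (cong r (h∘r y)) }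
  ... | yes rhp≡p = q , λ { y refl → p≢q (trans (sym rhp≡p) (cong r (trans hp≡hq (h∘r y)))) }

-- Deleting one of the two merged points leaves a surjective, hence injective, endomap of Fin m.
injective-off-merged : {g : Fin (suc m) → Fin m} → StrictlySurjective _≡_ g →
                       {u v : Fin (suc m)} → u ≢ v → g u ≡ g v →
                       {a b : Fin (suc m)} → a ≢ v → b ≢ v → g a ≡ g b → a ≡ b
injective-off-merged {m} {g} g-onto {u} {v} u≢v gu≡gv {a} {b} a≢v b≢v ga≡gb =
  begin
    a                           ≡⟨ punchIn-punchOut v≢a ⟨
    punchIn v (punchOut v≢a)    ≡⟨ cong (punchIn v) (surjective⇒injective h-onto h-eq) ⟩
    punchIn v (punchOut v≢b)    ≡⟨ punchIn-punchOut v≢b ⟩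
    b                           ∎
  where
  open ≡-Reasoning
  v≢a : v ≢ a
  v≢a = a≢v ∘ sym
  v≢b : v ≢ b
  v≢b = b≢v ∘ sym
  h : Fin m → Fin m
  h = g ∘ punchIn v
  h-onto : StrictlySurjective _≡_ h
  h-onto y with g-onto y
  ... | x , gx≡y with x ≟ v
  ...   | yes refl = punchOut (u≢v ∘ sym) , trans (cong g (punchIn-punchOut (u≢v ∘ sym))) (trans gu≡gv gx≡y)
  ...   | no  x≢v  = punchOut (x≢v ∘ sym) , trans (cong g (punchIn-punchOut (x≢v ∘ sym))) gx≡y
  h-eq : h (punchOut v≢a) ≡ h (punchOut v≢b)
  h-eq = trans (cong g (punchIn-punchOut v≢a)) (trans ga≡gb (sym (cong g (punchIn-punchOut v≢b))))

singleton-fibre : {g : Fin (suc m) → Fin m} → StrictlySurjective _≡_ g →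
                  {u v : Fin (suc m)} → u ≢ v → g u ≡ g v →
                  {p q : Fin (suc m)} → p ≢ u → p ≢ v → g q ≡ g p → q ≡ p
singleton-fibre g-onto {v = v} u≢v gu≡gv {p} {q} p≢u p≢v gq≡gp with q ≟ v
... | yes refl =
  contradiction (injective-off-merged g-onto u≢v gu≡gv p≢v u≢v (trans (sym gq≡gp) (sym gu≡gv))) p≢u
... | no  q≢v  = injective-off-merged g-onto u≢v gu≡gv q≢v p≢v gq≡gp

record QuotientMap (G H : Graph) : Set where
  field
    map        : Fin (size G) → Fin (size H)
    surjective : StrictlySurjective _≡_ map
    preserve   : ∀ {u v} → Adj G u v → Adj H (map u) (map v)
    reflect    : ∀ {x y} → Adj H x y → ∃₂ λ u v → map u ≡ x × map v ≡ y × Adj G u v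

≅⇒QuotientMap : {G H : Graph} {P : Partition (size G)} → Quotient G P ≅ H → QuotientMap G H
≅⇒QuotientMap {G} {H} {P} iso = record
  { map        = to ∘ block P
  ; surjective = surjective′
  ; preserve   = λ {u} {v} u~v → preserve _ _ (u , v , refl , refl , u~v)
  ; reflect    = reflect′
  }
  where
  open _≅_ iso
  open Bijection bij using (to; strictlySurjective)
  surjective′ : StrictlySurjective _≡_ (to ∘ block P)
  surjective′ y =
    let b , to-b≡y    = strictlySurjective y
        u , block-u≡b = onto P b
    in  u , trans (cong to block-u≡b) to-b≡y
  reflect′ : ∀ {x y} → Adj H x y → ∃₂ λ u v → to (block P u) ≡ x × to (block P v) ≡ y × Adj G u v
  reflect′ {x} {y} x~y with a , refl ← strictlySurjective x | b , refl ← strictlySurjective y =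
    let u , v , block-u≡a , block-v≡b , u~v = reflect a b x~y
    in  u , v , cong to block-u≡a , cong to block-v≡b , u~v

module _ {n : ℕ} (φ : QuotientMap (Cycle (3 + n)) (Cycle (2 + n))) where
  open QuotientMap φ renaming (map to g)

  module MergedPair {u v : Fin (3 + n)} (u≢v : u ≢ v) (gu≡gv : g u ≡ g v) where

    Touches : Fin (3 + n) → Set
    Touches t = CycleAdj (3 + n) u t ⊎ CycleAdj (3 + n) v t

    u≁v : ¬ CycleAdj (3 + n) u v
    u≁v u~v = CycleAdj-irrefl (s<s z<s) (g u) (subst (CycleAdj (2 + n) (g u)) (sym gu≡gv) (preserve u~v))

    v≁u : ¬ CycleAdj (3 + n) v u
    v≁u v~u = CycleAdj-irrefl (s<s z<s) (g u) (subst (λ x → CycleAdj (2 + n) x (g u)) (sym gu≡gv) (preserve v~u))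

    touches-outside : ∀ {t} → Touches t → t ≢ u × t ≢ v
    touches-outside (inj₁ u~t) = adjacent-outside (s<s z<s) u≁v u~t
    touches-outside (inj₂ v~t) with t≢v , t≢u ← adjacent-outside (s<s z<s) v≁u v~t = t≢u , t≢v

    touches-image : ∀ {t} → Touches t → CycleAdj (2 + n) (g u) (g t)
    touches-image (inj₁ u~t) = preserve u~t
    touches-image {t} (inj₂ v~t) = subst (λ x → CycleAdj (2 + n) x (g t)) (sym gu≡gv) (preserve v~t)

    touches-fibre : ∀ {t t′} → Touches t → g t′ ≡ g t → t′ ≡ t
    touches-fibre T with t≢u , t≢v ← touches-outside T = singleton-fibre surjective u≢v gu≡gv t≢u t≢v

    -- g u has only two neighbours, and g is injective on the neighbours of u and v.
    three-touching : ∀ {t₁ t₂ t₃} → Touches t₁ → Touches t₂ → Touches t₃ →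
                     t₁ ≢ t₂ → t₁ ≢ t₃ → t₂ ≢ t₃ → ⊥
    three-touching T₁ T₂ T₃ t₁≢t₂ t₁≢t₃ t₂≢t₃
      with among-two (neighbour T₁) (neighbour T₂) (neighbour T₃)
      where
      neighbour : ∀ {t} → Touches t → g t ≡ next (g u) ⊎ g t ≡ prev (g u)
      neighbour = adjacent⇒next⊎prev ∘ touches-image
    ... | inj₁ g₁≡g₂        = t₁≢t₂ (touches-fibre T₂ g₁≡g₂)
    ... | inj₂ (inj₁ g₁≡g₃) = t₁≢t₃ (touches-fibre T₃ g₁≡g₃)
    ... | inj₂ (inj₂ g₂≡g₃) = t₂≢t₃ (touches-fibre T₃ g₂≡g₃)

    next-u-touches : Touches (next u)
    next-u-touches = inj₁ (next-adjacent u)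

    prev-u-touches : Touches (prev u)
    prev-u-touches = inj₁ (prev-adjacent u)

    next-v-touches : Touches (next v)
    next-v-touches = inj₂ (next-adjacent v)

    prev-v-touches : Touches (prev v)
    prev-v-touches = inj₂ (prev-adjacent v)

    next-u≢prev-u : next u ≢ prev u
    next-u≢prev-u = next≢prev (s<s (s<s z<s)) u

    -- In the remaining case C_{n+3} is the square u, next u, v, prev u, so C_{n+2} is a
    -- triangle, whose edge between g (next u) and g (prev u) has no preimage.
    square : next u ≡ prev v → prev u ≡ next v → ⊥
    square nu≡pv pu≡nv = next-u≁prev-u preimage-edge
      where
      open ≡-Reasoning
      next⁴-u≡u : next^ 4 u ≡ u
      next⁴-u≡u = begin
        next (next (next (next u))) ≡⟨ cong (next ∘ next ∘ next) nu≡pv ⟩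
        next (next (next (prev v))) ≡⟨ cong (next ∘ next) (next-prev v) ⟩
        next (next v)               ≡⟨ cong next pu≡nv ⟨
        next (prev u)               ≡⟨ next-prev u ⟩
        u                           ∎
      image-edge : CycleAdj (2 + n) (g (next u)) (g (prev u))
      image-edge = triangle-complete target-is-triangle (next-u≢prev-u ∘ touches-fibre prev-u-touches)
        where
        target-is-triangle : 2 + n ≡ 3
        target-is-triangle = suc-injective (∣4⇒≡4 (s≤s (s≤s (s≤s z≤n))) (next^-fixed⇒∣ next⁴-u≡u))
      preimage-edge : CycleAdj (3 + n) (next u) (prev u)
      preimage-edge with p , q , gp≡gnu , gq≡gpu , p~q ← reflect image-edge
        rewrite touches-fibre next-u-touches gp≡gnu | touches-fibre prev-u-touches gq≡gpu = p~q
      next-u≁prev-u : ¬ CycleAdj (3 + n) (next u) (prev u)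
      next-u≁prev-u adj with adjacent⇒next⊎prev adj
      ... | inj₁ pu≡nnu = next^-irrefl (s<s z<s) u (begin
            next u                      ≡⟨ cong next (trans (cong next (sym pu≡nnu)) (next-prev u)) ⟨
            next (next (next (next u))) ≡⟨ next⁴-u≡u ⟩
            u                           ∎)
      ... | inj₂ pu≡pnu = proj₁ (touches-outside prev-u-touches) (trans pu≡pnu (prev-next u))

    absurd : ⊥
    absurd with next u ≟ prev v | prev u ≟ next v
    ... | no  nu≢pv | _         = three-touching next-u-touches prev-u-touches prev-v-touches
                                    next-u≢prev-u nu≢pv (u≢v ∘ prev-injective)
    ... | yes _     | no  pu≢nv = three-touching next-u-touches prev-u-touches next-v-touches
                                    next-u≢prev-u (u≢v ∘ next-injective) pu≢nv
    ... | yes nu≡pv | yes pu≡nv = square nu≡pv pu≡nv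

  no-QuotientMap-onto-shorter-cycle : ⊥
  no-QuotientMap-onto-shorter-cycle with i , j , i<j , gi≡gj ← pigeonhole (n<1+n (2 + n)) g =
    MergedPair.absurd (<⇒≢ i<j ∘ cong toℕ) gi≡gj

lemma4p2 : ∀ (k : ℕ) → 3 ≤ k → ¬ (Σ (Partition k) λ P → Quotient (Cycle k) P ≅ Cycle (k ∸ 1))
lemma4p2 0 ()
lemma4p2 1 (s≤s ())
lemma4p2 2 (s≤s (s≤s ()))
lemma4p2 (suc (suc (suc n))) _ (P , iso) = no-QuotientMap-onto-shorter-cycle {n} (≅⇒QuotientMap {P = P} iso)
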